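{- For every real $M>0$ there exists an instance of the Penalized Knapsack Problem whose optimal value $z^*$ satisfies $UB_{sub}^+-z^*\ge M$, $UB_{sub}-z^*\ge M$ and $z^{LP}-z^*\ge M$; that is, these three differences can be arbitrarily large.
   Context: An instance of the Penalized Knapsack Problem (PKP) consists of $n$ items with non-negative integer profits $p_j$, weights $w_j$, penalties $\pi_j$, and a capacity $c$; items are indexed so that $\pi_1\ge\dots\ge\pi_n$. PKP: choose $x\in\{0,1\}^n$ with $\sum_j w_jx_j\le c$ maximizing $\sum_j p_jx_j-\max\{\pi_j:x_j=1\}$ (max over the empty set is $0$); $z^*$ is its optimal value. $z^{LP}$ is the optimal value of the linear relaxation: maximize $\sum_j p_jx_j-\Pi$ s.t. $\sum_j w_jx_j\le c$, $\pi_jx_j\le\Pi$, $0\le x_j\le 1$. $z(PKP_j^{LP})$ is the LP-relaxation value of the 0--1 knapsack problem on items $\{j,\dots,n\}$ with capacity $c$, minus $\pi_j$; $z(PKP_j^{+LP})$ is $p_j-\pi_j$ plus the LP-relaxation value of the 0--1 knapsack problem on items $\{j+1,\dots,n\}$ with capacity $c-w_j$ ($-\infty$ if $w_j>c$). $UB_{sub}=\max_j z(PKP_j^{LP})$, $UB_{sub}^+=\max_j z(PKP_j^{+LP})$.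
   Formalization: The bound M ranges over the positive rationals instead of the positive reals. -}

module Defs where

open import Data.Nat as ℕ using (ℕ; zero; suc)
open import Data.Integer using (+_)
open import Data.Rational using (ℚ; _/_; 0ℚ; 1ℚ; _+_; _-_; _*_; _≤_)
open import Data.Fin using (Fin; zero; suc; toℕ)
open import Data.Bool using (Bool; if_then_else_)
open import Data.Product using (Σ; _×_; ∃)
open import Relation.Binary.PropositionalEquality using (_≡_)

⟦_⟧ : ℕ → ℚ
⟦ n ⟧ = + n / 1

Σℚ : (n : ℕ) → (Fin n → ℚ) → ℚ
Σℚ zero    f = 0ℚ
Σℚ (suc n) f = f zero + Σℚ n (λ i → f (suc i))

Σℕ : (n : ℕ) → (Fin n → ℕ) → ℕ
Σℕ zero    f = 0
Σℕ (suc n) f = f zero ℕ.+ Σℕ n (λ i → f (suc i))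

-- maximum over Fin n, 0 for n = 0 (all values are ≥ 0, so this is the
-- maximum over the selected items with max ∅ = 0)
maxℕ : (n : ℕ) → (Fin n → ℕ) → ℕ
maxℕ zero    f = 0
maxℕ (suc n) f = f zero ℕ.⊔ maxℕ n (λ i → f (suc i))

-- A PKP instance with n items indexed by Fin n (item j of the paper is
-- index j-1 here); penalties are non-increasing: π₁ ≥ … ≥ πₙ.
record PKP (n : ℕ) : Set where
  field
    p  : Fin n → ℕ
    w  : Fin n → ℕ
    π  : Fin n → ℕ
    c  : ℕ
    sorted : ∀ (i j : Fin n) → toℕ i ℕ.≤ toℕ j → π j ℕ.≤ π i

module _ {n : ℕ} (I : PKP n) where
  open PKP I

  Feasible : (Fin n → Bool) → Set
  Feasible x = Σℕ n (λ i → if x i then w i else 0) ℕ.≤ c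

  value : (Fin n → Bool) → ℚ
  value x = ⟦ Σℕ n (λ i → if x i then p i else 0) ⟧
          - ⟦ maxℕ n (λ i → if x i then π i else 0) ⟧

  IsOptimalValue : ℚ → Set
  IsOptimalValue z =
    (Σ (Fin n → Bool) λ x → Feasible x × value x ≡ z)
    × (∀ (x : Fin n → Bool) → Feasible x → value x ≤ z)

  InUnitBox : (Fin n → ℚ) → Set
  InUnitBox x = ∀ i → (0ℚ ≤ x i) × (x i ≤ 1ℚ)

  Σw : (Fin n → ℚ) → ℚ
  Σw x = Σℚ n (λ i → ⟦ w i ⟧ * x i)

  Σp : (Fin n → ℚ) → ℚ
  Σp x = Σℚ n (λ i → ⟦ p i ⟧ * x i)

  -- The LP  max Σ p_j x_j − Π  s.t. Σ w_j x_j ≤ c,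
  -- π_j x_j ≤ Π, 0 ≤ x_j ≤ 1  is feasible and bounded, so its optimum is
  -- attained and  z^LP ≥ t  iff some feasible (x, Π) has objective ≥ t.
  zLP-≥ : ℚ → Set
  zLP-≥ t = Σ (Fin n → ℚ) λ x → Σ ℚ λ Π →
              InUnitBox x × (Σw x ≤ ⟦ c ⟧)
              × (∀ i → ⟦ π i ⟧ * x i ≤ Π)
              × (t ≤ Σp x - Π)

  -- z(PKP_j^LP) ≥ t : the LP relaxation of the knapsack on items {j,…,n}
  -- with capacity c has a feasible point of value ≥ t + π_j.
  zPKPjLP-≥ : Fin n → ℚ → Set
  zPKPjLP-≥ j t = Σ (Fin n → ℚ) λ x →
              InUnitBox x
              × (∀ i → toℕ i ℕ.< toℕ j → x i ≡ 0ℚ)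
              × (Σw x ≤ ⟦ c ⟧)
              × (t ≤ Σp x - ⟦ π j ⟧)

  -- z(PKP_j^{+LP}) ≥ t : w_j ≤ c (otherwise the value is −∞) and the LP
  -- relaxation of the knapsack on items {j+1,…,n} with capacity c − w_j
  -- has a feasible point x with  p_j − π_j + Σ p x ≥ t.
  zPKPj⁺LP-≥ : Fin n → ℚ → Set
  zPKPj⁺LP-≥ j t = (w j ℕ.≤ c) × (Σ (Fin n → ℚ) λ x →
              InUnitBox x
              × (∀ i → toℕ i ℕ.≤ toℕ j → x i ≡ 0ℚ)
              × (Σw x ≤ ⟦ c ℕ.∸ w j ⟧)
              × (t ≤ (⟦ p j ⟧ - ⟦ π j ⟧) + Σp x))

  -- UB_sub = max_j z(PKP_j^LP) ≥ t
  UBsub-≥ : ℚ → Set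
  UBsub-≥ t = Σ (Fin n) λ j → zPKPjLP-≥ j t

  -- UB_sub^+ = max_j z(PKP_j^{+LP}) ≥ t
  UBsub⁺-≥ : ℚ → Set
  UBsub⁺-≥ t = Σ (Fin n) λ j → zPKPj⁺LP-≥ j t

module Submission where

open import Defs
open import Data.Nat using (ℕ)
open import Data.Rational using (ℚ; 0ℚ; _<_; _+_)
open import Data.Product using (Σ; _×_)

import Data.Nat as ℕ
import Data.Nat.Properties as ℕP
import Data.Integer as ℤ
import Data.Integer.Properties as ℤP
open import Data.Integer using (+_; -[1+_])
open import Data.Rational using (mkℚ; _/_; -_; _*_; _-_; _≤_; _≤?_; ½; 1ℚ; *≤*)
import Data.Rational.Properties as ℚP
open import Data.Rational.Solver using (module +-*-Solver)
open import Data.Nat.Coprimality using (1-coprimeTo)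
import Data.Nat.Coprimality as Coprime
open import Data.Fin using (Fin; zero; suc)
open import Data.Bool using (Bool; true; false)
open import Data.Product using (_,_; proj₁; proj₂)
open import Relation.Binary.PropositionalEquality
  using (_≡_; refl; sym; trans; cong; cong₂; subst; subst₂)
open import Relation.Nullary.Decidable using (True; toWitness)

-- Take two identical items of profit K, weight 2 and penalty
-- 0, with capacity 3.  Only one item fits, so z* = K.  The fractional
-- point (1, ½) fills the capacity exactly and is feasible for the LP
-- relaxation and for the relaxation PKP_1^LP; the point (0, ½) is feasible
-- for PKP_1^{+LP} (first item taken integrally, residual capacity 1).  All
-- three relaxations therefore reach K + K/2, a gap of K/2 over z*.
-- Choosing K = 2m with m ≥ M (every rational lies below some natural)
-- makes the gap at least M.

⟦⟧-normal : ∀ n → ⟦ n ⟧ ≡ mkℚ (+ n) 0 (Coprime.sym (1-coprimeTo n))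
⟦⟧-normal n = ℚP.normalize-coprime (Coprime.sym (1-coprimeTo n))

⟦+⟧ : ∀ a b → ⟦ a ℕ.+ b ⟧ ≡ ⟦ a ⟧ + ⟦ b ⟧
⟦+⟧ a b rewrite ⟦⟧-normal a | ⟦⟧-normal b | ℕP.*-identityʳ a | ℕP.*-identityʳ b =
  sym (cong (_/ 1) (cong₂ ℤ._+_ (ℤP.+◃n≡+n a) (ℤP.+◃n≡+n b)))

0≤⟦⟧ : ∀ n → 0ℚ ≤ ⟦ n ⟧
0≤⟦⟧ n rewrite ⟦⟧-normal n = *≤* (subst (+ 0 ℤ.≤_) (ℤP.pos-* n 1) (ℤ.+≤+ ℕ.z≤n))

-- Archimedean property: every rational lies below some natural number
-- (its numerator, when non-negative; zero otherwise).
ℕ-above : ∀ (M : ℚ) → Σ ℕ λ m → M ≤ ⟦ m ⟧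
ℕ-above M@(mkℚ (+ n) d _) =
  n , subst (M ≤_) (sym (⟦⟧-normal n))
        (*≤* (subst₂ ℤ._≤_ (ℤP.pos-* n 1) (ℤP.pos-* n (ℕ.suc d))
                (ℤ.+≤+ (ℕP.*-monoʳ-≤ n (ℕ.s≤s ℕ.z≤n)))))
ℕ-above (mkℚ -[1+ n ] _ _) =
  0 , *≤* (subst (ℤ._≤ + 0) (sym (ℤP.*-identityʳ -[1+ n ])) ℤ.-≤+)

open +-*-Solver using (solve; _:+_; _:*_; _:-_; con; _:=_)

half-double : ∀ m → ⟦ m ℕ.+ m ⟧ * ½ ≡ ⟦ m ⟧
half-double m = trans (cong (_* ½) (⟦+⟧ m m)) (halve ⟦ m ⟧)
  where
  halve : ∀ a → (a + a) * ½ ≡ a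
  halve = solve 1 (λ a → (a :+ a) :* con ½ := a) refl

-- Inequalities between closed rational expressions, decided by evaluation.
-- (The implicit proof of True is the unit value, found by unification.)
decided : ∀ {a b : ℚ} {holds : True (a ≤? b)} → a ≤ b
decided {a} {b} {holds} = toWitness {a? = a ≤? b} holds

twoItems : ℕ → PKP 2
twoItems K = record
  { p = λ _ → K ; w = λ _ → 2 ; π = λ _ → 0 ; c = 3
  ; sorted = λ _ _ _ → ℕ.z≤n }

oneItem : ℕ → ℚ
oneItem K = ⟦ K ⟧ - ⟦ 0 ⟧

-- Since 2 + 2 > 3 at most one item fits, and one item is worth K.
twoItems-optimal : ∀ K → IsOptimalValue (twoItems K) (oneItem K)
twoItems-optimal K = (firstOnly , ℕ.s≤s (ℕ.s≤s ℕ.z≤n) , packFirst) , bounded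
  where
  firstOnly : Fin 2 → Bool
  firstOnly zero = true
  firstOnly (suc zero) = false

  packFirst : ⟦ K ℕ.+ 0 ⟧ - ⟦ 0 ⟧ ≡ oneItem K
  packFirst = cong (λ k → ⟦ k ⟧ - ⟦ 0 ⟧) (ℕP.+-identityʳ K)

  bounded : ∀ x → Feasible (twoItems K) x → value (twoItems K) x ≤ oneItem K
  bounded x feasible with x zero | x (suc zero)
  bounded x (ℕ.s≤s (ℕ.s≤s (ℕ.s≤s ()))) | true | true
  ... | true  | false rewrite ℕP.+-identityʳ K = ℚP.≤-refl
  ... | false | true  rewrite ℕP.+-identityʳ K = ℚP.≤-refl
  ... | false | false = ℚP.+-monoˡ-≤ (- ⟦ 0 ⟧) (0≤⟦⟧ K)

point : ℚ → ℚ → Fin 2 → ℚ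
point a b zero = a
point a b (suc zero) = b

-- z(PKP_1^{+LP}) ≥ K + K/2: take item 1, then half of item 2 fills the
-- residual capacity 3 − 2 = 1.
twoItems-UBsub⁺ : ∀ K t → t ≤ oneItem K + ⟦ K ⟧ * ½ → UBsub⁺-≥ (twoItems K) t
twoItems-UBsub⁺ K t t≤ =
  zero , ℕ.s≤s (ℕ.s≤s ℕ.z≤n) , point 0ℚ ½
  , (λ { zero → decided , decided ; (suc zero) → decided , decided })
  , (λ { zero _ → refl ; (suc zero) () })
  , decided
  , subst (t ≤_) (objective ⟦ K ⟧) t≤
  where
  objective : ∀ a → (a - ⟦ 0 ⟧) + a * ½ ≡ (a - ⟦ 0 ⟧) + (a * 0ℚ + (a * ½ + 0ℚ))
  objective = solve 1 (λ a → (a :- con ⟦ 0 ⟧) :+ a :* con ½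
                          := (a :- con ⟦ 0 ⟧) :+ (a :* con 0ℚ :+ (a :* con ½ :+ con 0ℚ))) refl

-- The point (1, ½) uses weight 2 + 1 = 3 and earns K + K/2.
halfPoint-objective : ∀ a → (a - ⟦ 0 ⟧) + a * ½ ≡ (a * 1ℚ + (a * ½ + 0ℚ)) - ⟦ 0 ⟧
halfPoint-objective = solve 1 (λ a → (a :- con ⟦ 0 ⟧) :+ a :* con ½
                                 := (a :* con 1ℚ :+ (a :* con ½ :+ con 0ℚ)) :- con ⟦ 0 ⟧) refl

twoItems-UBsub : ∀ K t → t ≤ oneItem K + ⟦ K ⟧ * ½ → UBsub-≥ (twoItems K) t
twoItems-UBsub K t t≤ =
  zero , point 1ℚ ½
  , (λ { zero → decided , decided ; (suc zero) → decided , decided })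
  , (λ { _ () })
  , decided
  , subst (t ≤_) (halfPoint-objective ⟦ K ⟧) t≤

twoItems-zLP : ∀ K t → t ≤ oneItem K + ⟦ K ⟧ * ½ → zLP-≥ (twoItems K) t
twoItems-zLP K t t≤ =
  point 1ℚ ½ , ⟦ 0 ⟧
  , (λ { zero → decided , decided ; (suc zero) → decided , decided })
  , decided
  , (λ { zero → decided ; (suc zero) → decided })
  , subst (t ≤_) (halfPoint-objective ⟦ K ⟧) t≤

proposition2 : ∀ (M : ℚ) → 0ℚ < M →
    Σ ℕ λ n → Σ (PKP n) λ I → Σ ℚ λ zstar →
    IsOptimalValue I zstar
    × UBsub⁺-≥ I (zstar + M)
    × UBsub-≥ I (zstar + M)
    × zLP-≥ I (zstar + M)
proposition2 M _ =
  2 , twoItems K , oneItem K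
  , twoItems-optimal K
  , twoItems-UBsub⁺ K _ gap
  , twoItems-UBsub K _ gap
  , twoItems-zLP K _ gap
  where
  m : ℕ
  m = proj₁ (ℕ-above M)
  K : ℕ
  K = m ℕ.+ m
  -- z* + M ≤ z* + m = z* + K/2
  gap : oneItem K + M ≤ oneItem K + ⟦ K ⟧ * ½
  gap = subst (λ h → oneItem K + M ≤ oneItem K + h) (sym (half-double m))
              (ℚP.+-monoʳ-≤ (oneItem K) (proj₂ (ℕ-above M)))
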